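{- The set $\Omega(3,1)$ of all integers distinguished with respect to $(3,1)$ is the union of an infinite collection of arithmetic progressions of the form $\{a+dm : m=0,1,2,\dots\}$ with $a,d$ positive integers.
   Context: For integers $s$ and $r\ge 1$ with $\gcd(r,s)=1$, $\operatorname{ord}_r(s)$ denotes the least positive integer $m$ with $s^m\equiv 1\pmod r$. An integer $r\ge 2$ is distinguished with respect to $(3,1)$ if $\gcd(r,3)=1$ and $r$ divides $\frac{3^{\operatorname{ord}_r(3)}-1}{3-1}$. -}

module Defs where

open import Data.Nat using (ℕ; _∸_; _^_; _/_; _<_; _≤_)
open import Data.Nat.Divisibility using (_∣_)
open import Data.Nat.Coprimality using (Coprime)
open import Data.Product using (Σ; _×_)
open import Relation.Nullary using (¬_)

-- s^m ≡ 1 (mod r), for s ≥ 1 (so that s^m ∸ 1 is the true difference).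
PowCongOne : ℕ → ℕ → ℕ → Set
PowCongOne r s m = r ∣ (s ^ m ∸ 1)

IsOrd : ℕ → ℕ → ℕ → Set
IsOrd r s m = (0 < m) × PowCongOne r s m × (∀ k → 0 < k → k < m → ¬ PowCongOne r s k)

Distinguished31 : ℕ → Set
Distinguished31 r =
  (2 ≤ r) × Coprime r 3 × Σ ℕ (λ m → IsOrd r 3 m × r ∣ ((3 ^ m ∸ 1) / 2))

InAP : ℕ → ℕ → ℕ → Set
InAP a d r = Σ ℕ (λ m → r ≡ a + d * m)
  where open import Data.Nat using (_+_; _*_)
        open import Relation.Binary.PropositionalEquality using (_≡_)

-- Multiplying a distinguished r by any t coprime to 6 keeps it distinguished: with m = ord_r 3
-- and M = ord_{rt} 3 one has m ∣ M, so 2r ∣ 3^m − 1 ∣ 3^M − 1; as also rt ∣ 3^M − 1 and t is odd,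
-- 2rt ∣ 3^M − 1. Hence Ω(3,1) is the union over i of the progressions a_i (1 + 6(i+1)ℕ), where
-- a_i is i if i is distinguished and 5 otherwise; the factor i + 1 makes the progressions distinct.
module Submission where

open import Defs
open import Data.Nat.Base
open import Data.Nat.Properties
open import Data.Nat.Divisibility
open import Data.Nat.DivMod using (_%_; _/_; _mod_; m≡m%n+[m/n]*n; m%n<n)
open import Data.Nat.Coprimality using (Coprime; coprime?; coprime-divisor; coprime-+; 1-coprimeTo; 0-coprimeTo-m⇒m≡1)
import Data.Nat.Coprimality as Coprime
open import Data.Nat.Tactic.RingSolver using (solve-∀)
open import Data.Fin.Base using (Fin; toℕ)
open import Data.Fin.Properties using (pigeonhole; toℕ-fromℕ<)
open import Data.Product using (Σ; _×_; _,_; proj₁; proj₂)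
open import Data.Sum using (_⊎_; inj₁; inj₂; [_,_])
open import Data.Empty using (⊥-elim)
open import Function.Base using (_∘_)
open import Function.Bundles using (_⇔_; mk⇔)
open import Relation.Nullary using (¬_; yes; no)
open import Relation.Nullary.Decidable using (from-yes)
open import Relation.Unary using (Decidable)
open import Relation.Binary.Definitions using (tri<; tri≈; tri>)
open import Relation.Binary.PropositionalEquality using (_≡_; refl; sym; trans; cong; cong₂; subst; module ≡-Reasoning)

private
  variable
    d m n o r s t x : ℕ

MinimalPositive : (ℕ → Set) → ℕ → Set
MinimalPositive P m = 0 < m × P m × (∀ k → 0 < k → k < m → ¬ P k)

module _ {P : ℕ → Set} (P? : Decidable P) where

  private
    noneUpTo-or-minimal : ∀ n → (∀ k → 0 < k → k ≤ n → ¬ P k) ⊎ Σ ℕ (MinimalPositive P)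
    noneUpTo-or-minimal zero = inj₁ λ k 0<k k≤0 _ → <⇒≱ 0<k k≤0
    noneUpTo-or-minimal (suc n) with noneUpTo-or-minimal n
    ... | inj₂ minimal = inj₂ minimal
    ... | inj₁ none with P? (suc n)
    ...   | yes Pn+1 = inj₂ (suc n , z<s , Pn+1 , λ k 0<k k<n+1 → none k 0<k (s≤s⁻¹ k<n+1))
    ...   | no ¬Pn+1 = inj₁ λ k 0<k k≤n+1 →
      [ none k 0<k ∘ s≤s⁻¹ , (λ { refl → ¬Pn+1 }) ] (m≤n⇒m<n∨m≡n k≤n+1)

  minimalPositive : 0 < n → P n → Σ ℕ (MinimalPositive P)
  minimalPositive {n} 0<n Pn with noneUpTo-or-minimal n
  ... | inj₁ none    = ⊥-elim (none n 0<n ≤-refl Pn)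
  ... | inj₂ minimal = minimal

minimalPositive-unique : ∀ {P} → MinimalPositive P m → MinimalPositive P n → m ≡ n
minimalPositive-unique {m} {n} (0<m , Pm , below-m) (0<n , Pn , below-n) with <-cmp m n
... | tri< m<n _ _ = ⊥-elim (below-n m 0<m m<n Pm)
... | tri≈ _ m≡n _ = m≡n
... | tri> _ _ n<m = ⊥-elim (below-m n 0<n n<m Pn)

coprime-∣ʳ : Coprime m n → d ∣ n → Coprime m d
coprime-∣ʳ m⊥n d∣n (i∣m , i∣d) = m⊥n (i∣m , ∣-trans i∣d d∣n)

coprime-*ʳ : Coprime m n → Coprime m o → Coprime m (n * o)
coprime-*ʳ m⊥n m⊥o (d∣m , d∣n*o) =
  m⊥o (d∣m , coprime-divisor (Coprime.sym (coprime-∣ʳ (Coprime.sym m⊥n) d∣m)) d∣n*o)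

coprime-^ʳ : ∀ k → Coprime m n → Coprime m (n ^ k)
coprime-^ʳ {m} zero    m⊥n = Coprime.sym (1-coprimeTo m)
coprime-^ʳ     (suc k) m⊥n = coprime-*ʳ m⊥n (coprime-^ʳ k m⊥n)

coprime-1+* : ∀ n k → Coprime (1 + k * n) n
coprime-1+* n zero    = 1-coprimeTo n
coprime-1+* n (suc k) = subst (λ x → Coprime x n) (+-suc n (k * n)) (coprime-+ (coprime-1+* n k))

coprime⇒nonZero : Coprime m n → .{{NonTrivial n}} → NonZero m
coprime⇒nonZero {zero} {n} 0⊥n = ⊥-elim (nonTrivial⇒≢1 {n} (0-coprimeTo-m⇒m≡1 0⊥n))
coprime⇒nonZero {suc m} _ = _

%-≡⇒∣∸ : ∀ m n .{{_ : NonZero n}} → m % n ≡ o % n → n ∣ o ∸ m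
%-≡⇒∣∸ {o} m n eq = divides (o / n ∸ m / n) (begin
  o ∸ m                                     ≡⟨ cong₂ _∸_ o≡m%n+[o/n]*n (m≡m%n+[m/n]*n m n) ⟩
  (m % n + o / n * n) ∸ (m % n + m / n * n) ≡⟨ [m+n]∸[m+o]≡n∸o (m % n) _ _ ⟩
  o / n * n ∸ m / n * n                     ≡⟨ *-distribʳ-∸ n (o / n) (m / n) ⟨
  (o / n ∸ m / n) * n                       ∎)
  where
  open ≡-Reasoning
  o≡m%n+[o/n]*n : o ≡ m % n + o / n * n
  o≡m%n+[o/n]*n = trans (m≡m%n+[m/n]*n o n) (cong (_+ o / n * n) (sym eq))

coprime⇒*-∣ : .{{_ : NonZero d}} → Coprime m n → m * d ∣ x → d * n ∣ x → m * (d * n) ∣ x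
coprime⇒*-∣ {d} {m} {n} m⊥n m*d∣x (divides q refl) = *-monoˡ-∣ (d * n) m∣q
  where
  m∣q*n : m ∣ q * n
  m∣q*n = *-cancelʳ-∣ d (subst (m * d ∣_) q*[d*n]≡q*n*d m*d∣x)
    where
    q*[d*n]≡q*n*d : q * (d * n) ≡ q * n * d
    q*[d*n]≡q*n*d = trans (cong (q *_) (*-comm d n)) (sym (*-assoc q n d))
  m∣q : m ∣ q
  m∣q = coprime-divisor m⊥n (subst (m ∣_) (*-comm q n) m∣q*n)

suc[m^n∸1]≡m^n : ∀ m .{{_ : NonZero m}} n → suc (m ^ n ∸ 1) ≡ m ^ n
suc[m^n∸1]≡m^n m n = m+[n∸m]≡n (m^n>0 m n)

m^[n+o]∸1≡m^n∸1+m^n*[m^o∸1] : ∀ m .{{_ : NonZero m}} n o →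
                               m ^ (n + o) ∸ 1 ≡ (m ^ n ∸ 1) + m ^ n * (m ^ o ∸ 1)
m^[n+o]∸1≡m^n∸1+m^n*[m^o∸1] m n o = suc-injective (begin
  suc (m ^ (n + o) ∸ 1)               ≡⟨ suc[m^n∸1]≡m^n m (n + o) ⟩
  m ^ (n + o)                         ≡⟨ ^-distribˡ-+-* m n o ⟩
  m ^ n * m ^ o                       ≡⟨ cong (m ^ n *_) (suc[m^n∸1]≡m^n m o) ⟨
  m ^ n * suc (m ^ o ∸ 1)             ≡⟨ *-suc (m ^ n) _ ⟩
  m ^ n + m ^ n * (m ^ o ∸ 1)         ≡⟨ cong (_+ m ^ n * (m ^ o ∸ 1)) (suc[m^n∸1]≡m^n m n) ⟨
  suc (m ^ n ∸ 1) + m ^ n * (m ^ o ∸ 1) ∎)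
  where open ≡-Reasoning

m^[n+o]∸m^n≡m^n*[m^o∸1] : ∀ m n o → m ^ (n + o) ∸ m ^ n ≡ m ^ n * (m ^ o ∸ 1)
m^[n+o]∸m^n≡m^n*[m^o∸1] m n o = begin
  m ^ (n + o) ∸ m ^ n         ≡⟨ cong₂ _∸_ (^-distribˡ-+-* m n o) (sym (*-identityʳ (m ^ n))) ⟩
  m ^ n * m ^ o ∸ m ^ n * 1   ≡⟨ *-distribˡ-∸ (m ^ n) (m ^ o) 1 ⟨
  m ^ n * (m ^ o ∸ 1)         ∎
  where open ≡-Reasoning

module _ .{{_ : NonZero s}} where

  powCongOne-+ : PowCongOne r s m → PowCongOne r s n → PowCongOne r s (m + n)
  powCongOne-+ {r} {m} {n} r∣m r∣n =
    subst (r ∣_) (sym (m^[n+o]∸1≡m^n∸1+m^n*[m^o∸1] s m n)) (∣m∣n⇒∣m+n r∣m (∣n⇒∣m*n (s ^ m) r∣n))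

  powCongOne-* : ∀ q → PowCongOne r s m → PowCongOne r s (q * m)
  powCongOne-* zero    _   = _ ∣0
  powCongOne-* {m = m} (suc q) r∣m = powCongOne-+ {m = m} {n = q * m} r∣m (powCongOne-* q r∣m)

  powCongOne-∣ : m ∣ n → PowCongOne r s m → PowCongOne r s n
  powCongOne-∣ (divides q refl) = powCongOne-* q

  powCongOne-cancelˡ-+ : Coprime r s → PowCongOne r s m → PowCongOne r s (m + n) → PowCongOne r s n
  powCongOne-cancelˡ-+ {r} {m} {n} r⊥s r∣m r∣m+n = coprime-divisor (coprime-^ʳ m r⊥s)
    (∣m+n∣m⇒∣n (subst (r ∣_) (m^[n+o]∸1≡m^n∸1+m^n*[m^o∸1] s m n) r∣m+n) r∣m)

  pred∣powCongOne : ∀ n → PowCongOne (s ∸ 1) s n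
  pred∣powCongOne n = subst (PowCongOne (s ∸ 1) s) (*-identityʳ n)
    (powCongOne-* n (subst (λ x → s ∸ 1 ∣ x ∸ 1) (sym (*-identityʳ s)) ∣-refl))

  isOrd⇒∣ : Coprime r s → IsOrd r s m → PowCongOne r s n → m ∣ n
  isOrd⇒∣ {r} {m} {n} r⊥s (0<m , r∣m , below-m) r∣n = m%n≡0⇒n∣m n m n%m≡0
    where
    instance
      m≢0 : NonZero m
      m≢0 = >-nonZero 0<m
    r∣n%m : PowCongOne r s (n % m)
    r∣n%m = powCongOne-cancelˡ-+ {m = n / m * m} r⊥s (powCongOne-∣ (n∣m*n (n / m)) r∣m)
      (subst (PowCongOne r s) (trans (m≡m%n+[m/n]*n n m) (+-comm (n % m) _)) r∣n)
    n%m≡0 : n % m ≡ 0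
    n%m≡0 with n % m | r∣n%m | m%n<n n m
    ... | zero  | _     | _   = refl
    ... | suc k | r∣k+1 | k<m = ⊥-elim (below-m (suc k) z<s k<m r∣k+1)

powCongOne-∃ : .{{_ : NonZero r}} → Coprime r s → Σ ℕ λ m → 0 < m × PowCongOne r s m
powCongOne-∃ {r} {s} r⊥s with pigeonhole (n<1+n r) (λ (k : Fin (suc r)) → s ^ toℕ k mod r)
... | i , j , i<j , same = toℕ j ∸ toℕ i , m<n⇒0<n∸m i<j , r∣
  where
  e : ℕ
  e = toℕ j ∸ toℕ i
  same% : s ^ toℕ i % r ≡ s ^ toℕ j % r
  same% = trans (sym (toℕ-fromℕ< _)) (trans (cong toℕ same) (toℕ-fromℕ< _))
  s^j∸s^i≡s^i*[s^e∸1] : s ^ toℕ j ∸ s ^ toℕ i ≡ s ^ toℕ i * (s ^ e ∸ 1)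
  s^j∸s^i≡s^i*[s^e∸1] = trans (cong (λ k → s ^ k ∸ s ^ toℕ i) (sym (m+[n∸m]≡n (<⇒≤ i<j))))
                              (m^[n+o]∸m^n≡m^n*[m^o∸1] s (toℕ i) e)
  r∣ : PowCongOne r s e
  r∣ = coprime-divisor (coprime-^ʳ (toℕ i) r⊥s)
         (subst (r ∣_) s^j∸s^i≡s^i*[s^e∸1] (%-≡⇒∣∸ (s ^ toℕ i) r same%))

ord : .{{_ : NonZero r}} → Coprime r s → Σ ℕ (IsOrd r s)
ord {r} {s} r⊥s = let m , 0<m , r∣m = powCongOne-∃ r⊥s in
  minimalPositive (λ k → r ∣? (s ^ k ∸ 1)) 0<m r∣m

distinguished-*ʳ : Distinguished31 r → Coprime t 6 → Distinguished31 (r * t)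
distinguished-*ʳ {r} {t} (2≤r , r⊥3 , m , ord-m , r∣) t⊥6 = 2≤r*t , r*t⊥3 , M , ord-M , r*t∣
  where
  instance
    r≢0 : NonZero r
    r≢0 = >-nonZero (≤-trans (s≤s z≤n) 2≤r)
    t≢0 : NonZero t
    t≢0 = coprime⇒nonZero t⊥6
    r*t≢0 : NonZero (r * t)
    r*t≢0 = m*n≢0 r t
  2≤r*t : 2 ≤ r * t
  2≤r*t = ≤-trans 2≤r (m≤m*n r t)
  t⊥3 : Coprime t 3
  t⊥3 = coprime-∣ʳ t⊥6 (divides 2 refl)
  r*t⊥3 : Coprime (r * t) 3
  r*t⊥3 = Coprime.sym (coprime-*ʳ (Coprime.sym r⊥3) (Coprime.sym t⊥3))
  M : ℕ
  M = proj₁ (ord r*t⊥3)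
  ord-M : IsOrd (r * t) 3 M
  ord-M = proj₂ (ord r*t⊥3)
  r*t∣M : PowCongOne (r * t) 3 M
  r*t∣M = proj₁ (proj₂ ord-M)
  2*r∣M : PowCongOne (2 * r) 3 M
  2*r∣M = powCongOne-∣ {m = m} {n = M} (isOrd⇒∣ {n = M} r⊥3 ord-m (∣-trans (m∣m*n t) r*t∣M))
                                        (m∣n/o⇒o*m∣n (pred∣powCongOne m) r∣)
  2⊥t : Coprime 2 t
  2⊥t = Coprime.sym (coprime-∣ʳ t⊥6 (divides 3 refl))
  r*t∣ : r * t ∣ (3 ^ M ∸ 1) / 2
  r*t∣ = m*n∣o⇒n∣o/m 2 (r * t) (coprime⇒*-∣ {d = r} 2⊥t 2*r∣M r*t∣M)

distinguished? : Decidable Distinguished31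
distinguished? r with 2 ≤? r | coprime? r 3
... | no 2≰r | _       = no (2≰r ∘ proj₁)
... | yes _  | no ¬r⊥3 = no (¬r⊥3 ∘ proj₁ ∘ proj₂)
... | yes 2≤r | yes r⊥3 with ord {{>-nonZero (≤-trans (s≤s z≤n) 2≤r)}} r⊥3
...   | m , ord-m with r ∣? (3 ^ m ∸ 1) / 2
...     | yes r∣ = yes (2≤r , r⊥3 , m , ord-m , r∣)
...     | no r∤  = no λ (_ , _ , m′ , ord-m′ , r∣) →
                     r∤ (subst (λ k → r ∣ (3 ^ k ∸ 1) / 2) (minimalPositive-unique ord-m′ ord-m) r∣)

distinguished-5 : Distinguished31 5
distinguished-5 = from-yes (distinguished? 5)

start : ℕ → ℕ
start i with distinguished? i
... | yes _ = i
... | no _  = 5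

step : ℕ → ℕ
step i = start i * (suc i * 6)

start-distinguished : ∀ i → Distinguished31 (start i)
start-distinguished i with distinguished? i
... | yes i-dist = i-dist
... | no _       = distinguished-5

start-fixed : Distinguished31 r → start r ≡ r
start-fixed {r} r-dist with distinguished? r
... | yes _     = refl
... | no ¬r-dist = ⊥-elim (¬r-dist r-dist)

start-positive : ∀ i → 0 < start i
start-positive i = ≤-trans (s≤s z≤n) (proj₁ (start-distinguished i))

step-positive : ∀ i → 0 < step i
step-positive i = >-nonZero⁻¹ (step i) {{m*n≢0 (start i) (suc i * 6) {{>-nonZero (start-positive i)}}}}

start-step-injective : ∀ i j → start i ≡ start j → step i ≡ step j → i ≡ j
start-step-injective i j start-i≡start-j step-i≡step-j =
  suc-injective (*-cancelʳ-≡ (suc i) (suc j) 6 (*-cancelˡ-≡ _ _ (start j) {{>-nonZero (start-positive j)}}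
    (subst (λ a → a * (suc i * 6) ≡ step j) start-i≡start-j step-i≡step-j)))

progression-factor : ∀ a b k → a + a * (b * 6) * k ≡ a * (1 + b * k * 6)
progression-factor = solve-∀

corollary2p6 : Σ (ℕ → ℕ) (λ a → Σ (ℕ → ℕ) (λ d →
      ((i : ℕ) → (0 < a i) × (0 < d i))
    × ((i j : ℕ) → a i ≡ a j → d i ≡ d j → i ≡ j)
    × ((r : ℕ) → Distinguished31 r ⇔ Σ ℕ (λ i → InAP (a i) (d i) r))))
corollary2p6 = start , step , (λ i → start-positive i , step-positive i) , start-step-injective ,
  λ r → mk⇔ (λ r-dist → r , 0 , own-progression r-dist) in-progression⇒distinguished
  where
  own-progression : Distinguished31 r → r ≡ start r + step r * 0
  own-progression {r} r-dist = sym (trans (cong₂ _+_ (start-fixed r-dist) (*-zeroʳ (step r))) (+-identityʳ r))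
  in-progression⇒distinguished : Σ ℕ (λ i → InAP (start i) (step i) r) → Distinguished31 r
  in-progression⇒distinguished (i , k , refl) =
    subst Distinguished31 (sym (progression-factor (start i) (suc i) k))
      (distinguished-*ʳ (start-distinguished i) (coprime-1+* 6 (suc i * k)))
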